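{- Let $G$ be a finite group with exactly three involutions, not all pairs of which commute. Then either $G\cong S_3$, or the power graph $P(G)$ has a perfect matching.
   Context: The power graph $P(G)$ of a finite group $G$ is the simple undirected graph with vertex set $G$ in which distinct $x,y$ are adjacent iff one is a power of the other. A perfect matching is a set of pairwise vertex-disjoint edges covering every vertex. -}

module Defs where

open import Data.Nat using (ℕ)
open import Data.Fin using (Fin)
open import Data.Sum using (_⊎_)
open import Data.Product using (Σ; _×_; Σ-syntax)
open import Relation.Binary.PropositionalEquality using (_≡_)
open import Relation.Nullary using (¬_)
open import Data.Fin.Permutation using (Permutation′; _⟨$⟩ʳ_; _∘ₚ_)

-- A finite group, presented with carrier Fin order (every finite group
-- is isomorphic to one of this form) and propositional equality.
record FiniteGroup : Set where
  field
    order : ℕ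
    _·_   : Fin order → Fin order → Fin order
    e     : Fin order
    inv   : Fin order → Fin order
    assoc : ∀ x y z → (x · y) · z ≡ x · (y · z)
    identityˡ : ∀ x → e · x ≡ x
    identityʳ : ∀ x → x · e ≡ x
    inverseˡ  : ∀ x → inv x · x ≡ e
    inverseʳ  : ∀ x → x · inv x ≡ e

module _ (G : FiniteGroup) where
  open FiniteGroup G

  Elt : Set
  Elt = Fin order

  pow : Elt → ℕ → Elt
  pow x ℕ.zero    = e
  pow x (ℕ.suc k) = x · pow x k

  IsInvolution : Elt → Set
  IsInvolution x = ¬ (x ≡ e) × (x · x ≡ e)

  ExactlyThreeInvolutions : Set
  ExactlyThreeInvolutions =
    Σ[ a ∈ Elt ] Σ[ b ∈ Elt ] Σ[ c ∈ Elt ]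
      (¬ (a ≡ b) × ¬ (a ≡ c) × ¬ (b ≡ c)
      × IsInvolution a × IsInvolution b × IsInvolution c
      × (∀ x → IsInvolution x → (x ≡ a) ⊎ (x ≡ b) ⊎ (x ≡ c)))

  InvolutionsNotAllCommute : Set
  InvolutionsNotAllCommute =
    ¬ (∀ x y → IsInvolution x → IsInvolution y → x · y ≡ y · x)

  PowerAdj : Elt → Elt → Set
  PowerAdj x y = ¬ (x ≡ y) × ((Σ[ k ∈ ℕ ] y ≡ pow x k) ⊎ (Σ[ k ∈ ℕ ] x ≡ pow y k))

  -- a perfect matching of P(G): a set M of edges (a symmetric relation
  -- on vertices), every edge of M an edge of P(G), such that every vertex
  -- lies in exactly one edge of M (i.e. the edges are pairwise disjoint
  -- and cover all vertices)
  IsPerfectMatching : (Elt → Elt → Set) → Set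
  IsPerfectMatching M =
    (∀ x y → M x y → M y x)
    × (∀ x y → M x y → PowerAdj x y)
    × (∀ x → Σ[ y ∈ Elt ] (M x y × (∀ z → M x z → z ≡ y)))

  HasPerfectMatching : Set₁
  HasPerfectMatching = Σ[ M ∈ (Elt → Elt → Set) ] IsPerfectMatching M

  -- G ≅ S₃: a bijective homomorphism to the permutations of Fin 3,
  -- with (σ τ)(i) = σ (τ i), i.e. σ τ = τ ∘ₚ σ in stdlib's diagrammatic order.
  -- Equality of permutations is pointwise.
  IsoToS3 : Set
  IsoToS3 =
    Σ[ φ ∈ (Elt → Permutation′ 3) ]
      ((∀ x y i → φ (x · y) ⟨$⟩ʳ i ≡ (φ y ∘ₚ φ x) ⟨$⟩ʳ i)
      × (∀ x y → (∀ i → φ x ⟨$⟩ʳ i ≡ φ y ⟨$⟩ʳ i) → x ≡ y)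
      × (∀ (σ : Permutation′ 3) → Σ[ x ∈ Elt ] (∀ i → φ x ⟨$⟩ʳ i ≡ σ ⟨$⟩ʳ i)))

{-# OPTIONS --safe #-}
-- Let a, b be non-commuting involutions. Then aba is a third involution, so the
-- involutions are exactly a, b, c = aba = bab, and conjugation permutes them: this gives
-- a homomorphism G → S₃, already onto on the words in a and b, whose kernel is the
-- centraliser Z of a and b. If Z is trivial, G ≅ S₃. Otherwise Z contains no involution
-- (none commutes with both a and b), so repeated squaring yields z ≠ e in Z of odd order m.
-- The twelve elements {e, a, b, c} · {1, z, z⁻¹} are closed under inversion and can be
-- paired along edges of P(G) using m odd; every other x satisfies x ≠ x⁻¹ and is paired
-- with x⁻¹, a power of x.
module Submission where

open import Algebra.Bundles using (Group)
import Algebra.Properties.Group as GroupProperties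
import Algebra.Properties.Monoid as MonoidProperties
open import Data.Empty using (⊥-elim)
open import Data.Fin using (Fin; toℕ)
open import Data.Fin.Patterns using (0F; 1F; 2F)
open import Data.Fin.Permutation as Perm
  using (Permutation′; permutation; transpose; _⟨$⟩ʳ_; _⟨$⟩ˡ_)
open import Data.Fin.Properties using (_≟_; any?; pigeonhole)
open import Data.List using (List; []; _∷_; cartesianProduct)
open import Data.List.Membership.Propositional using (_∈_; find; lose)
open import Data.List.Membership.Propositional.Properties using (∈-cartesianProduct⁺)
open import Data.List.Relation.Unary.Any as Any using (Any; here; there)
open import Data.Maybe using (Maybe; nothing; just)
open import Data.Nat using (ℕ; zero; suc; _+_; _∸_; _<_; s≤s)
open import Data.Nat.Induction using (<-wellFounded)
open import Data.Nat.Properties using (+-suc; m≤m+n; n<1+n; m+[n∸m]≡n)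
open import Data.Product using (Σ-syntax; ∃; _×_; _,_; proj₁; proj₂)
open import Data.Sum using (_⊎_; inj₁; inj₂; [_,_]′; map₂; swap)
open import Function using (_∘_; id)
open import Induction.WellFounded using (Acc; acc)
open import Level using (0ℓ)
open import Relation.Binary.Definitions using (DecidableEquality)
open import Relation.Binary.PropositionalEquality
open import Relation.Nullary using (¬_; Dec; yes; no; contradiction)
open import Relation.Nullary.Decidable using (map′; _×-dec_; ¬?; decidable-stable)

open import Defs

module PatchedInvolution
  {V L : Set} (_≟ᵥ_ : DecidableEquality V)
  (ι : V → V) (ι-involutive : ∀ x → ι (ι x) ≡ x)
  (labels : List L) (labels-complete : ∀ ℓ → ℓ ∈ labels)
  (elem : L → V) (elem-injective : ∀ {ℓ ℓ′} → elem ℓ ≡ elem ℓ′ → ℓ ≡ ℓ′)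
  (ι-label : L → L) (ι-elem : ∀ ℓ → ι (elem ℓ) ≡ elem (ι-label ℓ))
  (partner : L → L) (partner-involutive : ∀ ℓ → partner (partner ℓ) ≡ ℓ)
  where

  open ≡-Reasoning

  Labelled : V → Set
  Labelled x = ∃ λ ℓ → elem ℓ ≡ x

  labelled? : ∀ x → Dec (Labelled x)
  labelled? x = map′ found (λ (ℓ , eq) → lose (labels-complete ℓ) eq)
                     (Any.any? (λ ℓ → elem ℓ ≟ᵥ x) labels)
    where
    found : Any (λ ℓ → elem ℓ ≡ x) labels → Labelled x
    found p = let ℓ , _ , eq = find p in ℓ , eq

  patched : V → V
  patched x with labelled? x
  ... | yes (ℓ , _) = elem (partner ℓ)
  ... | no _        = ι x

  patched-labelled : ∀ ℓ → patched (elem ℓ) ≡ elem (partner ℓ)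
  patched-labelled ℓ with labelled? (elem ℓ)
  ... | yes (ℓ′ , eq)  = cong (elem ∘ partner) (elem-injective eq)
  ... | no unlabelled = contradiction (ℓ , refl) unlabelled

  patched-unlabelled : ∀ {x} → ¬ Labelled x → patched x ≡ ι x
  patched-unlabelled {x} unlabelled with labelled? x
  ... | yes labelled = contradiction labelled unlabelled
  ... | no _         = refl

  ι-unlabelled : ∀ {x} → ¬ Labelled x → ¬ Labelled (ι x)
  ι-unlabelled {x} unlabelled (ℓ , eq) = unlabelled (ι-label ℓ , (begin
    elem (ι-label ℓ) ≡⟨ ι-elem ℓ ⟨
    ι (elem ℓ)       ≡⟨ cong ι eq ⟩
    ι (ι x)          ≡⟨ ι-involutive x ⟩
    x                ∎))

  patched-involutive : ∀ x → patched (patched x) ≡ x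
  patched-involutive x = by-cases x (labelled? x)
    where
    by-cases : ∀ x → Dec (Labelled x) → patched (patched x) ≡ x
    by-cases _ (yes (ℓ , refl)) = begin
      patched (patched (elem ℓ)) ≡⟨ cong patched (patched-labelled ℓ) ⟩
      patched (elem (partner ℓ)) ≡⟨ patched-labelled (partner ℓ) ⟩
      elem (partner (partner ℓ)) ≡⟨ cong elem (partner-involutive ℓ) ⟩
      elem ℓ                     ∎
    by-cases x (no unlabelled) = begin
      patched (patched x) ≡⟨ cong patched (patched-unlabelled unlabelled) ⟩
      patched (ι x)       ≡⟨ patched-unlabelled (ι-unlabelled unlabelled) ⟩
      ι (ι x)             ≡⟨ ι-involutive x ⟩
      x                   ∎

⟨$⟩ʳ-injective : ∀ {n} (π : Permutation′ n) {i j} → π ⟨$⟩ʳ i ≡ π ⟨$⟩ʳ j → i ≡ j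
⟨$⟩ʳ-injective π {i} {j} eq = begin
  i                 ≡⟨ Perm.inverseˡ π ⟨
  π ⟨$⟩ˡ (π ⟨$⟩ʳ i) ≡⟨ cong (π ⟨$⟩ˡ_) eq ⟩
  π ⟨$⟩ˡ (π ⟨$⟩ʳ j) ≡⟨ Perm.inverseˡ π ⟩
  j                 ∎
  where open ≡-Reasoning

agree-off-point⇒agree : ∀ {n} (σ π : Permutation′ n) k →
  (∀ i → i ≢ k → σ ⟨$⟩ʳ i ≡ π ⟨$⟩ʳ i) → ∀ i → σ ⟨$⟩ʳ i ≡ π ⟨$⟩ʳ i
agree-off-point⇒agree σ π k agree i with i ≟ k
... | no i≢k = agree i i≢k
... | yes refl with σ ⟨$⟩ˡ (π ⟨$⟩ʳ i) ≟ i
...   | yes j≡i = trans (cong (σ ⟨$⟩ʳ_) (sym j≡i)) (Perm.inverseʳ σ)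
...   | no j≢i  = contradiction (⟨$⟩ʳ-injective π
                    (trans (sym (agree _ j≢i)) (Perm.inverseʳ σ))) j≢i

data Parity : ℕ → Set where
  even : ∀ j → Parity (j + j)
  odd  : ∀ j → Parity (suc (j + j))

parity : ∀ n → Parity n
parity zero = even 0
parity (suc n) with parity n
... | even j = odd j
... | odd j  = subst Parity (cong suc (+-suc j j)) (even (suc j))

-- A label (h , s) names the element base h · zˢ, where base 𝐞 , 𝐚 , 𝐛 , 𝐜
-- are e , a , b , c = aba and s ranges over 0 , 1 , -1.
Base : Set
Base = Maybe (Fin 3)

pattern 𝐞 = nothing
pattern 𝐚 = just 0F
pattern 𝐛 = just 1F
pattern 𝐜 = just 2F

data Sign : Set where
  0ˢ +ˢ -ˢ : Sign

negate : Sign → Sign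
negate 0ˢ = 0ˢ
negate +ˢ = -ˢ
negate -ˢ = +ˢ

Label : Set
Label = Base × Sign

inverse-label : Label → Label
inverse-label (h , s) = h , negate s

labels : List Label
labels = cartesianProduct (𝐞 ∷ 𝐚 ∷ 𝐛 ∷ 𝐜 ∷ []) (0ˢ ∷ +ˢ ∷ -ˢ ∷ [])

labels-complete : ∀ ℓ → ℓ ∈ labels
labels-complete (h , s) = ∈-cartesianProduct⁺ (base∈ h) (sign∈ s)
  where
  base∈ : (h : Base) → h ∈ 𝐞 ∷ 𝐚 ∷ 𝐛 ∷ 𝐜 ∷ []
  base∈ 𝐞 = here refl
  base∈ 𝐚 = there (here refl)
  base∈ 𝐛 = there (there (here refl))
  base∈ 𝐜 = there (there (there (here refl)))
  sign∈ : (s : Sign) → s ∈ 0ˢ ∷ +ˢ ∷ -ˢ ∷ []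
  sign∈ 0ˢ = here refl
  sign∈ +ˢ = there (here refl)
  sign∈ -ˢ = there (there (here refl))

-- With m odd and z of order dividing m: e = c⁰, a = (az)ᵐ, z⁻¹ = (az⁻¹)ᵐ⁺¹,
-- b = (bz⁻¹)ᵐ, z = (bz)ᵐ⁺¹ and cz⁻¹ = (cz)⁻¹.
partner : Label → Label
partner (𝐞 , 0ˢ) = 𝐜 , 0ˢ
partner (𝐜 , 0ˢ) = 𝐞 , 0ˢ
partner (𝐚 , 0ˢ) = 𝐚 , +ˢ
partner (𝐚 , +ˢ) = 𝐚 , 0ˢ
partner (𝐚 , -ˢ) = 𝐞 , -ˢ
partner (𝐞 , -ˢ) = 𝐚 , -ˢ
partner (𝐛 , 0ˢ) = 𝐛 , -ˢ
partner (𝐛 , -ˢ) = 𝐛 , 0ˢ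
partner (𝐛 , +ˢ) = 𝐞 , +ˢ
partner (𝐞 , +ˢ) = 𝐛 , +ˢ
partner (𝐜 , +ˢ) = 𝐜 , -ˢ
partner (𝐜 , -ˢ) = 𝐜 , +ˢ

partner-involutive : ∀ ℓ → partner (partner ℓ) ≡ ℓ
partner-involutive (𝐞 , 0ˢ) = refl
partner-involutive (𝐜 , 0ˢ) = refl
partner-involutive (𝐚 , 0ˢ) = refl
partner-involutive (𝐚 , +ˢ) = refl
partner-involutive (𝐚 , -ˢ) = refl
partner-involutive (𝐞 , -ˢ) = refl
partner-involutive (𝐛 , 0ˢ) = refl
partner-involutive (𝐛 , -ˢ) = refl
partner-involutive (𝐛 , +ˢ) = refl
partner-involutive (𝐞 , +ˢ) = refl
partner-involutive (𝐜 , +ˢ) = refl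
partner-involutive (𝐜 , -ˢ) = refl

partner-fixfree : ∀ ℓ → partner ℓ ≢ ℓ
partner-fixfree (𝐞 , 0ˢ) ()
partner-fixfree (𝐜 , 0ˢ) ()
partner-fixfree (𝐚 , 0ˢ) ()
partner-fixfree (𝐚 , +ˢ) ()
partner-fixfree (𝐚 , -ˢ) ()
partner-fixfree (𝐞 , -ˢ) ()
partner-fixfree (𝐛 , 0ˢ) ()
partner-fixfree (𝐛 , -ˢ) ()
partner-fixfree (𝐛 , +ˢ) ()
partner-fixfree (𝐞 , +ˢ) ()
partner-fixfree (𝐜 , +ˢ) ()
partner-fixfree (𝐜 , -ˢ) ()

module PowerGraph (G : FiniteGroup) where
  open FiniteGroup G
  open ≡-Reasoning

  group : Group 0ℓ 0ℓ
  group = record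
    { Carrier = Elt G ; _≈_ = _≡_ ; _∙_ = _·_ ; ε = e ; _⁻¹ = inv
    ; isGroup = record
      { isMonoid = record
        { isSemigroup = record
          { isMagma = record { isEquivalence = isEquivalence ; ∙-cong = cong₂ _·_ }
          ; assoc = assoc }
        ; identity = identityˡ , identityʳ }
      ; inverse = inverseˡ , inverseʳ
      ; ⁻¹-cong = cong inv } }

  open GroupProperties group
    using (∙-cancelˡ; ∙-cancelʳ; inverseʳ-unique; ε⁻¹≈ε; ⁻¹-involutive; ⁻¹-anti-homo-∙)
  open MonoidProperties (Group.monoid group)
    renaming (ε-comm to commute-e; cancelˡ to cancel-involutionˡ; cancelʳ to cancel-involutionʳ)
    using ()

  infixr 25 _^_

  _^_ : Elt G → ℕ → Elt G
  x ^ n = pow G x n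

  Commute : Elt G → Elt G → Set
  Commute x y = x · y ≡ y · x

  self-inverse : ∀ {t} → t · t ≡ e → inv t ≡ t
  self-inverse {t} tt = sym (inverseʳ-unique t t tt)

  commute-∙ : ∀ {t x y} → Commute t x → Commute t y → Commute t (x · y)
  commute-∙ {t} {x} {y} tx ty = begin
    t · (x · y) ≡⟨ assoc t x y ⟨
    (t · x) · y ≡⟨ cong (_· y) tx ⟩
    (x · t) · y ≡⟨ assoc x t y ⟩
    x · (t · y) ≡⟨ cong (x ·_) ty ⟩
    x · (y · t) ≡⟨ assoc x y t ⟨
    (x · y) · t ∎

  commute-inv : ∀ {t x} → Commute t x → Commute t (inv x)
  commute-inv {t} {x} tx = ∙-cancelˡ x _ _ (begin
    x · (t · inv x) ≡⟨ assoc x t (inv x) ⟨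
    (x · t) · inv x ≡⟨ cong (_· inv x) tx ⟨
    (t · x) · inv x ≡⟨ assoc t x (inv x) ⟩
    t · (x · inv x) ≡⟨ cong (t ·_) (inverseʳ x) ⟩
    t · e           ≡⟨ commute-e t ⟩
    e · t           ≡⟨ cong (_· t) (inverseʳ x) ⟨
    (x · inv x) · t ≡⟨ assoc x (inv x) t ⟩
    x · (inv x · t) ∎)

  commute-^ : ∀ {t x} → Commute t x → ∀ n → Commute t (x ^ n)
  commute-^ {t} tx zero    = commute-e t
  commute-^     tx (suc n) = commute-∙ tx (commute-^ tx n)

  ^-+ : ∀ x m n → x ^ (m + n) ≡ x ^ m · x ^ n
  ^-+ x zero    n = sym (identityˡ _)
  ^-+ x (suc m) n = trans (cong (x ·_) (^-+ x m n)) (sym (assoc _ _ _))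

  ^-∙ : ∀ {x y} → Commute x y → ∀ n → (x · y) ^ n ≡ x ^ n · y ^ n
  ^-∙         xy zero    = sym (identityˡ e)
  ^-∙ {x} {y} xy (suc n) = begin
    (x · y) · (x · y) ^ n     ≡⟨ cong ((x · y) ·_) (^-∙ xy n) ⟩
    (x · y) · (x ^ n · y ^ n) ≡⟨ assoc x y _ ⟩
    x · (y · (x ^ n · y ^ n)) ≡⟨ cong (x ·_) (assoc y _ _) ⟨
    x · ((y · x ^ n) · y ^ n) ≡⟨ cong (λ w → x · (w · y ^ n)) (commute-^ (sym xy) n) ⟩
    x · ((x ^ n · y) · y ^ n) ≡⟨ cong (x ·_) (assoc _ y _) ⟩
    x · (x ^ n · (y · y ^ n)) ≡⟨ assoc x _ _ ⟨
    (x · x ^ n) · (y · y ^ n) ∎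

  e-^ : ∀ n → e ^ n ≡ e
  e-^ zero    = refl
  e-^ (suc n) = trans (identityˡ _) (e-^ n)

  ^-inv : ∀ x n → inv x ^ n ≡ inv (x ^ n)
  ^-inv x zero    = sym ε⁻¹≈ε
  ^-inv x (suc n) = begin
    inv x · inv x ^ n   ≡⟨ cong (inv x ·_) (^-inv x n) ⟩
    inv x · inv (x ^ n) ≡⟨ ⁻¹-anti-homo-∙ (x ^ n) x ⟨
    inv (x ^ n · x)     ≡⟨ cong inv (commute-^ refl n) ⟨
    inv (x · x ^ n)     ∎

  ^-double : ∀ x n → x ^ (n + n) ≡ (x · x) ^ n
  ^-double x n = trans (^-+ x n n) (sym (^-∙ refl n))

  involution-odd-power : ∀ {t w} j → t · t ≡ e → Commute t w → w ^ suc (j + j) ≡ e →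
    (t · w) ^ suc (j + j) ≡ t × (t · w) ^ suc (suc (j + j)) ≡ w
  involution-odd-power {t} {w} j tt tw wᵐ≡e = tᵐ , (begin
      (t · w) · (t · w) ^ suc (j + j) ≡⟨ cong ((t · w) ·_) tᵐ ⟩
      (t · w) · t                     ≡⟨ cong (_· t) tw ⟩
      (w · t) · t                     ≡⟨ cancel-involutionʳ tt w ⟩
      w                               ∎)
    where
    tᵐ : (t · w) ^ suc (j + j) ≡ t
    tᵐ = begin
      (t · w) ^ suc (j + j)             ≡⟨ ^-∙ tw (suc (j + j)) ⟩
      t ^ suc (j + j) · w ^ suc (j + j) ≡⟨ cong₂ _·_ (cong (t ·_) (^-double t j)) wᵐ≡e ⟩
      (t · (t · t) ^ j) · e             ≡⟨ cong (λ u → (t · u ^ j) · e) tt ⟩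
      (t · e ^ j) · e                   ≡⟨ cong (λ u → (t · u) · e) (e-^ j) ⟩
      (t · e) · e                       ≡⟨ trans (identityʳ _) (identityʳ t) ⟩
      t                                 ∎

  involution-product-commuting : ∀ {t u} → t · t ≡ e → Commute (t · u) t → Commute t u
  involution-product-commuting {t} {u} tt tu-t = sym (begin
    u · t             ≡⟨ cong (_· t) tut≡u ⟨
    ((t · u) · t) · t ≡⟨ cancel-involutionʳ tt (t · u) ⟩
    t · u             ∎)
    where
    tut≡u : (t · u) · t ≡ u
    tut≡u = trans tu-t (cancel-involutionˡ tt u)

  period : ∀ x → ∃ λ n → x ^ suc n ≡ e
  period x with pigeonhole (n<1+n order) (λ i → x ^ toℕ i)
  ... | i , j , i<j , xⁱ≡xʲ = d , ∙-cancelˡ (x ^ toℕ i) _ _ (begin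
      x ^ toℕ i · x ^ suc d  ≡⟨ ^-+ x (toℕ i) (suc d) ⟨
      x ^ (toℕ i + suc d)    ≡⟨ cong (x ^_) (trans (+-suc (toℕ i) d) (m+[n∸m]≡n i<j)) ⟩
      x ^ toℕ j              ≡⟨ xⁱ≡xʲ ⟨
      x ^ toℕ i              ≡⟨ identityʳ _ ⟨
      x ^ toℕ i · e          ∎)
    where
    d : ℕ
    d = toℕ j ∸ suc (toℕ i)

  inverse-power : ∀ x → ∃ λ k → inv x ≡ x ^ k
  inverse-power x = let n , xⁿ⁺¹≡e = period x in n , sym (inverseʳ-unique x _ xⁿ⁺¹≡e)

  conj : Elt G → Elt G → Elt G
  conj g t = (g · t) · inv g

  conj-e : ∀ t → conj e t ≡ t
  conj-e t = begin
    (e · t) · inv e ≡⟨ cong₂ _·_ (identityˡ t) ε⁻¹≈ε ⟩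
    t · e           ≡⟨ identityʳ t ⟩
    t               ∎

  conj-∙ : ∀ x y t → conj (x · y) t ≡ conj x (conj y t)
  conj-∙ x y t = begin
    ((x · y) · t) · inv (x · y)     ≡⟨ cong (((x · y) · t) ·_) (⁻¹-anti-homo-∙ x y) ⟩
    ((x · y) · t) · (inv y · inv x) ≡⟨ assoc _ (inv y) (inv x) ⟨
    (((x · y) · t) · inv y) · inv x ≡⟨ cong (λ u → (u · inv y) · inv x) (assoc x y t) ⟩
    ((x · (y · t)) · inv y) · inv x ≡⟨ cong (_· inv x) (assoc x (y · t) (inv y)) ⟩
    (x · ((y · t) · inv y)) · inv x ∎

  conj-injective : ∀ g {s t} → conj g s ≡ conj g t → s ≡ t
  conj-injective g eq = ∙-cancelˡ g _ _ (∙-cancelʳ (inv g) _ _ eq)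

  conj-∙-hom : ∀ g s t → conj g s · conj g t ≡ conj g (s · t)
  conj-∙-hom g s t = begin
    ((g · s) · inv g) · ((g · t) · inv g) ≡⟨ assoc _ (inv g) _ ⟩
    (g · s) · (inv g · ((g · t) · inv g)) ≡⟨ cong ((g · s) ·_) (assoc (inv g) _ (inv g)) ⟨
    (g · s) · ((inv g · (g · t)) · inv g) ≡⟨ cong (λ u → (g · s) · (u · inv g)) (assoc (inv g) g t) ⟨
    (g · s) · (((inv g · g) · t) · inv g) ≡⟨ cong (λ u → (g · s) · ((u · t) · inv g)) (inverseˡ g) ⟩
    (g · s) · ((e · t) · inv g)           ≡⟨ cong (λ u → (g · s) · (u · inv g)) (identityˡ t) ⟩
    (g · s) · (t · inv g)                 ≡⟨ assoc (g · s) t (inv g) ⟨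
    ((g · s) · t) · inv g                 ≡⟨ cong (_· inv g) (assoc g s t) ⟩
    (g · (s · t)) · inv g                 ∎

  conj-involution : ∀ {g t} → IsInvolution G t → IsInvolution G (conj g t)
  conj-involution {g} {t} (t≢e , tt) =
      (λ eq → t≢e (conj-injective g (trans eq (sym conj-g-e))))
    , trans (conj-∙-hom g t t) (trans (cong (conj g) tt) conj-g-e)
    where
    conj-g-e : conj g e ≡ e
    conj-g-e = trans (cong (_· inv g) (identityʳ g)) (inverseʳ g)

  conj-fixed⇒commute : ∀ {x y} → conj x y ≡ y → Commute x y
  conj-fixed⇒commute {x} {y} eq = begin
    x · y                 ≡⟨ identityʳ _ ⟨
    (x · y) · e           ≡⟨ cong ((x · y) ·_) (inverseˡ x) ⟨
    (x · y) · (inv x · x) ≡⟨ assoc _ (inv x) x ⟨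
    ((x · y) · inv x) · x ≡⟨ cong (_· x) eq ⟩
    y · x                 ∎

  commute⇒conj-fixed : ∀ {x y} → Commute x y → conj x y ≡ y
  commute⇒conj-fixed {x} {y} xy = begin
    (x · y) · inv x ≡⟨ cong (_· inv x) xy ⟩
    (y · x) · inv x ≡⟨ assoc y x (inv x) ⟩
    y · (x · inv x) ≡⟨ cong (y ·_) (inverseʳ x) ⟩
    y · e           ≡⟨ identityʳ y ⟩
    y               ∎

  conj-self : ∀ x → conj x x ≡ x
  conj-self x = commute⇒conj-fixed refl

  conj-equal⇒commute : ∀ {x y t} → conj x t ≡ conj y t → Commute (inv y · x) t
  conj-equal⇒commute {x} {y} {t} eq = conj-fixed⇒commute (begin
    conj (inv y · x) t      ≡⟨ conj-∙ (inv y) x t ⟩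
    conj (inv y) (conj x t) ≡⟨ cong (conj (inv y)) eq ⟩
    conj (inv y) (conj y t) ≡⟨ conj-∙ (inv y) y t ⟨
    conj (inv y · y) t      ≡⟨ cong (λ g → conj g t) (inverseˡ y) ⟩
    conj e t                ≡⟨ conj-e t ⟩
    t                       ∎)

  conj-conj-involution : ∀ {x} → x · x ≡ e → ∀ y → conj x (conj x y) ≡ y
  conj-conj-involution {x} xx y = begin
    conj x (conj x y) ≡⟨ conj-∙ x x y ⟨
    conj (x · x) y    ≡⟨ cong (λ g → conj g y) xx ⟩
    conj e y          ≡⟨ conj-e y ⟩
    y                 ∎

  noncommuting-conj : ∀ {x y} → ¬ Commute x y → conj x y ≢ x × conj x y ≢ y
  noncommuting-conj {x} {y} x∤y =
      (λ eq → x∤y (subst (Commute x) (sym (conj-injective x (trans eq (sym (conj-self x))))) refl))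
    , (λ eq → x∤y (conj-fixed⇒commute eq))

  PowerRelated : Elt G → Elt G → Set
  PowerRelated x y = (∃ λ k → y ≡ x ^ k) ⊎ (∃ λ k → x ≡ y ^ k)

  involution⇒perfect-matching : (f : Elt G → Elt G) → (∀ x → f (f x) ≡ x) →
    (∀ x → PowerAdj G x (f x)) → HasPerfectMatching G
  involution⇒perfect-matching f f-involutive f-adjacent =
    Matched , symmetric , (λ { x _ refl → f-adjacent x }) , λ x → f x , refl , λ _ eq → eq
    where
    Matched : Elt G → Elt G → Set
    Matched x y = y ≡ f x
    symmetric : ∀ x y → Matched x y → Matched y x
    symmetric x _ refl = sym (f-involutive x)

  InvolutionsAmong : Elt G → Elt G → Elt G → Set
  InvolutionsAmong x y z = ∀ t → IsInvolution G t → t ≡ x ⊎ t ≡ y ⊎ t ≡ z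

  among-swap : ∀ {x y z} → InvolutionsAmong x y z → InvolutionsAmong x z y
  among-swap among t t-inv = map₂ swap (among t t-inv)

  among-rotate : ∀ {x y z} → InvolutionsAmong x y z → InvolutionsAmong y z x
  among-rotate among t t-inv = [ inj₂ ∘ inj₂ , map₂ inj₁ ]′ (among t t-inv)

  commute-among : ∀ {x y z s} → InvolutionsAmong x y z →
    Commute s x → Commute s y → Commute s z → ∀ t → IsInvolution G t → Commute s t
  commute-among among sx sy sz t t-inv with among t t-inv
  ... | inj₁ refl        = sx
  ... | inj₂ (inj₁ refl) = sy
  ... | inj₂ (inj₂ refl) = sz

  pairwise⇒all-commute : ∀ {x y z} → InvolutionsAmong x y z →
    Commute x y → Commute x z → Commute y z →
    ∀ s t → IsInvolution G s → IsInvolution G t → Commute s t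
  pairwise⇒all-commute among xy xz yz s t s-inv with among s s-inv
  ... | inj₁ refl        = commute-among among refl xy xz t
  ... | inj₂ (inj₁ refl) = commute-among among (sym xy) refl yz t
  ... | inj₂ (inj₂ refl) = commute-among among (sym xz) (sym yz) refl t

  conj-is-third : ∀ {x y z} → IsInvolution G y → ¬ Commute x y →
    InvolutionsAmong x y z → conj x y ≡ z
  conj-is-third y-inv x∤y among with among _ (conj-involution y-inv)
  ... | inj₁ eq        = contradiction eq (proj₁ (noncommuting-conj x∤y))
  ... | inj₂ (inj₁ eq) = contradiction eq (proj₂ (noncommuting-conj x∤y))
  ... | inj₂ (inj₂ eq) = eq

  record NonCommutingPair : Set where
    field
      a b          : Elt G
      a-involution : IsInvolution G a
      b-involution : IsInvolution G b
      a∤b          : ¬ Commute a b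
      among        : InvolutionsAmong a b (conj a b)

  noncommuting⇒pair : ∀ {x y z} → IsInvolution G x → IsInvolution G y → ¬ Commute x y →
    InvolutionsAmong x y z → NonCommutingPair
  noncommuting⇒pair {x} {y} {z} x-inv y-inv x∤y among = record
    { a-involution = x-inv ; b-involution = y-inv ; a∤b = x∤y
    ; among = λ t t-inv → map₂ (map₂ (λ t≡z → trans t≡z (sym third))) (among t t-inv) }
    where
    third : conj x y ≡ z
    third = conj-is-third y-inv x∤y among

  noncommuting-pair : ExactlyThreeInvolutions G → InvolutionsNotAllCommute G → NonCommutingPair
  noncommuting-pair (a , b , c , _ , _ , _ , a-inv , b-inv , c-inv , among) not-all
    with a · b ≟ b · a | a · c ≟ c · a | b · c ≟ c · b
  ... | no a∤b | _      | _      = noncommuting⇒pair a-inv b-inv a∤b among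
  ... | yes _  | no a∤c | _      = noncommuting⇒pair a-inv c-inv a∤c (among-swap among)
  ... | yes _  | yes _  | no b∤c = noncommuting⇒pair b-inv c-inv b∤c (among-rotate among)
  ... | yes ab | yes ac | yes bc = contradiction (pairwise⇒all-commute among ab ac bc) not-all

  module S₃Pair (P : NonCommutingPair) where
    open NonCommutingPair P

    c : Elt G
    c = conj a b

    a≢b : a ≢ b
    a≢b refl = a∤b refl

    c≢a : c ≢ a
    c≢a = proj₁ (noncommuting-conj a∤b)

    c≢b : c ≢ b
    c≢b = proj₂ (noncommuting-conj a∤b)

    conj-b-a : conj b a ≡ c
    conj-b-a = conj-is-third a-involution (a∤b ∘ sym)
                 (among-rotate (among-rotate (among-swap among)))

    conj-a-c : conj a c ≡ b
    conj-a-c = conj-conj-involution (proj₂ a-involution) b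

    conj-b-c : conj b c ≡ a
    conj-b-c = trans (cong (conj b) (sym conj-b-a)) (conj-conj-involution (proj₂ b-involution) a)

    a∤c : ¬ Commute a c
    a∤c ac = c≢b (trans (sym (commute⇒conj-fixed ac)) conj-a-c)

    b∤c : ¬ Commute b c
    b∤c bc = c≢a (trans (sym (commute⇒conj-fixed bc)) conj-b-c)

    commuting-involutions : ∀ {x y} → IsInvolution G x → IsInvolution G y → Commute x y → x ≡ y
    commuting-involutions x-inv y-inv xy with among _ x-inv | among _ y-inv
    ... | inj₁ refl        | inj₁ refl        = refl
    ... | inj₁ refl        | inj₂ (inj₁ refl) = contradiction xy a∤b
    ... | inj₁ refl        | inj₂ (inj₂ refl) = contradiction xy a∤c
    ... | inj₂ (inj₁ refl) | inj₁ refl        = contradiction (sym xy) a∤b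
    ... | inj₂ (inj₁ refl) | inj₂ (inj₁ refl) = refl
    ... | inj₂ (inj₁ refl) | inj₂ (inj₂ refl) = contradiction xy b∤c
    ... | inj₂ (inj₂ refl) | inj₁ refl        = contradiction (sym xy) a∤c
    ... | inj₂ (inj₂ refl) | inj₂ (inj₁ refl) = contradiction (sym xy) b∤c
    ... | inj₂ (inj₂ refl) | inj₂ (inj₂ refl) = refl

    Central : Elt G → Set
    Central z = Commute z a × Commute z b

    central? : ∀ z → Dec (Central z)
    central? z = (z · a ≟ a · z) ×-dec (z · b ≟ b · z)

    central-commutes : ∀ {z} → Central z → ∀ {t} → IsInvolution G t → Commute z t
    central-commutes (za , zb) t-inv =
      commute-among among za zb (commute-∙ (commute-∙ za zb) (commute-inv za)) _ t-inv

    central-∙ : ∀ {x y} → Central x → Central y → Central (x · y)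
    central-∙ (xa , xb) (ya , yb) = sym (commute-∙ (sym xa) (sym ya)) , sym (commute-∙ (sym xb) (sym yb))

    central-inv : ∀ {x} → Central x → Central (inv x)
    central-inv (xa , xb) = sym (commute-inv (sym xa)) , sym (commute-inv (sym xb))

    central-not-involution : ∀ {z} → Central z → ¬ IsInvolution G z
    central-not-involution (za , zb) z-inv =
      a≢b (trans (sym (commuting-involutions z-inv a-involution za))
                 (commuting-involutions z-inv b-involution zb))

    reflection : Fin 3 → Elt G
    reflection 0F = a
    reflection 1F = b
    reflection 2F = c

    reflection-involution : ∀ i → IsInvolution G (reflection i)
    reflection-involution 0F = a-involution
    reflection-involution 1F = b-involution
    reflection-involution 2F = conj-involution b-involution

    -- Only meaningful on involutions: every x other than a and b gets 2F.
    index : Elt G → Fin 3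
    index x with x ≟ a | x ≟ b
    ... | yes _ | _     = 0F
    ... | no _  | yes _ = 1F
    ... | no _  | no _  = 2F

    reflection-index : ∀ {x} → IsInvolution G x → reflection (index x) ≡ x
    reflection-index {x} x-inv with x ≟ a | x ≟ b | among x x-inv
    ... | yes x≡a | _       | _                = sym x≡a
    ... | no _    | yes x≡b | _                = sym x≡b
    ... | no x≢a  | no _    | inj₁ x≡a         = contradiction x≡a x≢a
    ... | no _    | no x≢b  | inj₂ (inj₁ x≡b)  = contradiction x≡b x≢b
    ... | no _    | no _    | inj₂ (inj₂ x≡c)  = sym x≡c

    index-reflection : ∀ i → index (reflection i) ≡ i
    index-reflection 0F with a ≟ a
    ... | yes _   = refl
    ... | no a≢a  = contradiction refl a≢a
    index-reflection 1F with b ≟ a | b ≟ b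
    ... | yes b≡a | _      = contradiction (sym b≡a) a≢b
    ... | no _    | yes _  = refl
    ... | no _    | no b≢b = contradiction refl b≢b
    index-reflection 2F with c ≟ a | c ≟ b
    ... | yes c≡a | _       = contradiction c≡a c≢a
    ... | no _    | yes c≡b = contradiction c≡b c≢b
    ... | no _    | no _    = refl

    reflection-injective : ∀ {i j} → reflection i ≡ reflection j → i ≡ j
    reflection-injective {i} {j} eq =
      trans (sym (index-reflection i)) (trans (cong index eq) (index-reflection j))

    action : Elt G → Fin 3 → Fin 3
    action x i = index (conj x (reflection i))

    conj-reflection : ∀ x i → conj x (reflection i) ≡ reflection (action x i)
    conj-reflection x i = sym (reflection-index (conj-involution (reflection-involution i)))

    action-≡ : ∀ {x} i {j} → conj x (reflection i) ≡ reflection j → action x i ≡ j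
    action-≡ _ {j} eq = trans (cong index eq) (index-reflection j)

    action-∙ : ∀ x y i → action (x · y) i ≡ action x (action y i)
    action-∙ x y i = cong index (begin
      conj (x · y) (reflection i)      ≡⟨ conj-∙ x y (reflection i) ⟩
      conj x (conj y (reflection i))   ≡⟨ cong (conj x) (conj-reflection y i) ⟩
      conj x (reflection (action y i)) ∎)

    action-cancel : ∀ {x y} → x · y ≡ e → ∀ i → action x (action y i) ≡ i
    action-cancel {x} {y} xy i = begin
      action x (action y i) ≡⟨ action-∙ x y i ⟨
      action (x · y) i      ≡⟨ cong (λ g → action g i) xy ⟩
      action e i            ≡⟨ action-≡ i (conj-e (reflection i)) ⟩
      i                     ∎

    permutationOf : Elt G → Permutation′ 3
    permutationOf x =
      permutation (action x) (action (inv x)) (action-cancel (inverseʳ x)) (action-cancel (inverseˡ x))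

    action-injective : (∀ z → Central z → z ≡ e) →
      ∀ {x y} → (∀ i → action x i ≡ action y i) → x ≡ y
    action-injective trivial {x} {y} same = begin
      x             ≡⟨ inverseʳ-unique (inv y) x (trivial _ (fixes 0F , fixes 1F)) ⟩
      inv (inv y)   ≡⟨ ⁻¹-involutive y ⟩
      y             ∎
      where
      fixes : ∀ i → Commute (inv y · x) (reflection i)
      fixes i = conj-equal⇒commute (begin
        conj x (reflection i)   ≡⟨ conj-reflection x i ⟩
        reflection (action x i) ≡⟨ cong reflection (same i) ⟩
        reflection (action y i) ≡⟨ conj-reflection y i ⟨
        conj y (reflection i)   ∎)

    ActsAs : Elt G → (Fin 3 → Fin 3) → Set
    ActsAs x f = ∀ i → action x i ≡ f i

    acts-e : ActsAs e id
    acts-e i = action-≡ i (conj-e (reflection i))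

    acts-∙ : ∀ {x y f g} → ActsAs x f → ActsAs y g → ActsAs (x · y) (f ∘ g)
    acts-∙ {x} {y} {f} {g} x-acts y-acts i =
      trans (action-∙ x y i) (trans (cong (action x) (y-acts i)) (x-acts (g i)))

    acts-a : ActsAs a (transpose 1F 2F ⟨$⟩ʳ_)
    acts-a 0F = action-≡ 0F (conj-self a)
    acts-a 1F = action-≡ 1F refl
    acts-a 2F = action-≡ 2F conj-a-c

    acts-b : ActsAs b (transpose 0F 2F ⟨$⟩ʳ_)
    acts-b 0F = action-≡ 0F conj-b-a
    acts-b 1F = action-≡ 1F (conj-self b)
    acts-b 2F = action-≡ 2F conj-b-c

    acting : ∀ {x f} → ActsAs x f → Σ[ y ∈ Elt G ] (action y 0F ≡ f 0F × action y 1F ≡ f 1F)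
    acting {x} x-acts = x , x-acts 0F , x-acts 1F

    realise : ∀ p q → p ≢ q → Σ[ x ∈ Elt G ] (action x 0F ≡ p × action x 1F ≡ q)
    realise 0F 0F p≢q = contradiction refl p≢q
    realise 0F 1F _   = acting acts-e
    realise 0F 2F _   = acting acts-a
    realise 1F 0F _   = acting (acts-∙ (acts-∙ acts-a acts-b) acts-a)
    realise 1F 1F p≢q = contradiction refl p≢q
    realise 1F 2F _   = acting (acts-∙ acts-a acts-b)
    realise 2F 0F _   = acting (acts-∙ acts-b acts-a)
    realise 2F 1F _   = acting acts-b
    realise 2F 2F p≢q = contradiction refl p≢q

    isomorphism : (∀ z → Central z → z ≡ e) → IsoToS3 G
    isomorphism trivial =
      permutationOf , action-∙ , (λ _ _ → action-injective trivial) , surjective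
      where
      surjective : ∀ σ → Σ[ x ∈ Elt G ] (∀ i → action x i ≡ σ ⟨$⟩ʳ i)
      surjective σ with realise (σ ⟨$⟩ʳ 0F) (σ ⟨$⟩ʳ 1F) (λ eq → contradiction (⟨$⟩ʳ-injective σ eq) λ ())
      ... | x , x₀ , x₁ = x , agree-off-point⇒agree (permutationOf x) σ 2F off-2F
        where
        off-2F : ∀ i → i ≢ 2F → action x i ≡ σ ⟨$⟩ʳ i
        off-2F 0F _     = x₀
        off-2F 1F _     = x₁
        off-2F 2F 2F≢2F = contradiction refl 2F≢2F

    OddOrderCentral : Set
    OddOrderCentral = Σ[ w ∈ Elt G ] (Central w × w ≢ e × ∃ λ j → w ^ suc (j + j) ≡ e)

    -- Square z until the exponent is odd; squares stay ≢ e as no involution is central.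
    odd-order-central : ∀ {z} n → Central z → z ≢ e → z ^ suc n ≡ e → OddOrderCentral
    odd-order-central n = halve n (<-wellFounded n)
      where
      halve : ∀ {z} n → Acc _<_ n → Central z → z ≢ e → z ^ suc n ≡ e → OddOrderCentral
      halve {z} n (acc smaller) z-central z≢e zⁿ⁺¹≡e with parity n
      ... | even j = z , z-central , z≢e , j , zⁿ⁺¹≡e
      ... | odd j  = halve j (smaller (s≤s (m≤m+n j j))) (central-∙ z-central z-central)
                       (λ zz≡e → central-not-involution z-central (z≢e , zz≡e))
                       (begin
                         (z · z) ^ suc j       ≡⟨ ^-double z (suc j) ⟨
                         z ^ (suc j + suc j)   ≡⟨ cong (λ k → z ^ suc k) (+-suc j j) ⟩
                         z ^ suc (suc (j + j)) ≡⟨ zⁿ⁺¹≡e ⟩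
                         e                     ∎)

    module Matching (z : Elt G) (z-central : Central z) (z≢e : z ≢ e)
                    (j : ℕ) (z-odd : z ^ suc (j + j) ≡ e) where

      zpow : Sign → Elt G
      zpow 0ˢ = e
      zpow +ˢ = z
      zpow -ˢ = inv z

      base : Base → Elt G
      base 𝐞        = e
      base (just i) = reflection i

      elem : Label → Elt G
      elem (h , s) = base h · zpow s

      z⁻¹≢e : inv z ≢ e
      z⁻¹≢e eq = z≢e (trans (sym (⁻¹-involutive z)) (trans (cong inv eq) ε⁻¹≈ε))

      z≢z⁻¹ : z ≢ inv z
      z≢z⁻¹ eq = central-not-involution z-central (z≢e , trans (cong (z ·_) eq) (inverseʳ z))

      zpow-central : ∀ s → Central (zpow s)
      zpow-central 0ˢ = sym (commute-e a) , sym (commute-e b)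
      zpow-central +ˢ = z-central
      zpow-central -ˢ = central-inv z-central

      zpow-inverse : ∀ s → inv (zpow s) ≡ zpow (negate s)
      zpow-inverse 0ˢ = ε⁻¹≈ε
      zpow-inverse +ˢ = refl
      zpow-inverse -ˢ = ⁻¹-involutive z

      zpow-odd : ∀ s → zpow s ^ suc (j + j) ≡ e
      zpow-odd 0ˢ = e-^ (suc (j + j))
      zpow-odd +ˢ = z-odd
      zpow-odd -ˢ = trans (^-inv z (suc (j + j))) (trans (cong inv z-odd) ε⁻¹≈ε)

      zpow-injective : ∀ {s s′} → zpow s ≡ zpow s′ → s ≡ s′
      zpow-injective {0ˢ} {0ˢ} _   = refl
      zpow-injective {0ˢ} {+ˢ} eq  = contradiction (sym eq) z≢e
      zpow-injective {0ˢ} { -ˢ } eq  = contradiction (sym eq) z⁻¹≢e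
      zpow-injective {+ˢ} {0ˢ} eq  = contradiction eq z≢e
      zpow-injective {+ˢ} {+ˢ} _   = refl
      zpow-injective {+ˢ} { -ˢ } eq  = contradiction eq z≢z⁻¹
      zpow-injective { -ˢ } {0ˢ} eq  = contradiction eq z⁻¹≢e
      zpow-injective { -ˢ } {+ˢ} eq  = contradiction (sym eq) z≢z⁻¹
      zpow-injective { -ˢ } { -ˢ } _   = refl

      base-self-inverse : ∀ h → base h · base h ≡ e
      base-self-inverse 𝐞        = identityˡ e
      base-self-inverse (just i) = proj₂ (reflection-involution i)

      base-commutes : ∀ h {x} → Central x → Commute (base h) x
      base-commutes 𝐞        {x} _         = sym (commute-e x)
      base-commutes (just i)     x-central = sym (central-commutes x-central (reflection-involution i))

      elem-inverse : ∀ ℓ → inv (elem ℓ) ≡ elem (inverse-label ℓ)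
      elem-inverse (h , s) = begin
        inv (base h · zpow s)        ≡⟨ ⁻¹-anti-homo-∙ (base h) (zpow s) ⟩
        inv (zpow s) · inv (base h)  ≡⟨ cong₂ _·_ (zpow-inverse s) (self-inverse (base-self-inverse h)) ⟩
        zpow (negate s) · base h     ≡⟨ base-commutes h (zpow-central (negate s)) ⟨
        base h · zpow (negate s)     ∎

      base-product-central : ∀ h h′ → Central (base h · base h′) → h ≡ h′
      base-product-central 𝐞        𝐞        _       = refl
      base-product-central 𝐞        (just i) central =
        ⊥-elim (central-not-involution (subst Central (identityˡ _) central) (reflection-involution i))
      base-product-central (just i) 𝐞        central =
        ⊥-elim (central-not-involution (subst Central (identityʳ _) central) (reflection-involution i))
      base-product-central (just i) (just i′) central = cong just (reflection-injective
        (commuting-involutions (reflection-involution i) (reflection-involution i′)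
          (involution-product-commuting (proj₂ (reflection-involution i))
            (central-commutes central (reflection-involution i)))))

      base-cancel : ∀ {h h′ x y} → base h · x ≡ base h′ · y → Central x → Central y → h ≡ h′
      base-cancel {h} {h′} {x} {y} eq x-central y-central =
        sym (base-product-central h′ h (subst Central (sym u′u≡yx⁻¹) (central-∙ y-central (central-inv x-central))))
        where
        u′u≡yx⁻¹ : base h′ · base h ≡ y · inv x
        u′u≡yx⁻¹ = begin
          base h′ · base h                       ≡⟨ cong (base h′ ·_) (∙-cancelʳ x _ _ (begin
            base h · x                             ≡⟨ eq ⟩
            base h′ · y                            ≡⟨ cong (base h′ ·_) (identityʳ y) ⟨
            base h′ · (y · e)                      ≡⟨ cong (λ u → base h′ · (y · u)) (inverseˡ x) ⟨
            base h′ · (y · (inv x · x))            ≡⟨ cong (base h′ ·_) (assoc y (inv x) x) ⟨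
            base h′ · ((y · inv x) · x)            ≡⟨ assoc (base h′) _ x ⟨
            (base h′ · (y · inv x)) · x            ∎)) ⟩
          base h′ · (base h′ · (y · inv x))      ≡⟨ cancel-involutionˡ (base-self-inverse h′) (y · inv x) ⟩
          y · inv x                              ∎

      elem-injective : ∀ {ℓ ℓ′} → elem ℓ ≡ elem ℓ′ → ℓ ≡ ℓ′
      elem-injective {h , s} {h′ , s′} eq with base-cancel {h} {h′} eq (zpow-central s) (zpow-central s′)
      ... | refl = cong (h ,_) (zpow-injective (∙-cancelˡ (base h) _ _ eq))

      open PatchedInvolution _≟_ inv ⁻¹-involutive labels labels-complete
        elem elem-injective inverse-label elem-inverse partner partner-involutive

      self-inverse-labelled : ∀ {x} → x · x ≡ e → Labelled x
      self-inverse-labelled {x} xx with x ≟ e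
      ... | yes refl = (𝐞 , 0ˢ) , identityˡ e
      ... | no x≢e   = (just (index x) , 0ˢ) , trans (identityʳ _) (reflection-index (x≢e , xx))

      odd-power-split : ∀ i s →
        (reflection i · zpow s) ^ suc (j + j) ≡ reflection i × (reflection i · zpow s) ^ suc (suc (j + j)) ≡ zpow s
      odd-power-split i s = involution-odd-power j (base-self-inverse (just i))
                              (base-commutes (just i) (zpow-central s)) (zpow-odd s)

      partner-power : ∀ ℓ → PowerRelated (elem ℓ) (elem (partner ℓ))
      partner-power (𝐞 , 0ˢ) = inj₂ (0 , identityˡ e)
      partner-power (𝐚 , 0ˢ) = inj₂ (suc (j + j) , trans (identityʳ a) (sym (proj₁ (odd-power-split 0F +ˢ))))
      partner-power (𝐚 , -ˢ) = inj₁ (suc (suc (j + j)) , trans (identityˡ _) (sym (proj₂ (odd-power-split 0F -ˢ))))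
      partner-power (𝐛 , 0ˢ) = inj₂ (suc (j + j) , trans (identityʳ b) (sym (proj₁ (odd-power-split 1F -ˢ))))
      partner-power (𝐛 , +ˢ) = inj₁ (suc (suc (j + j)) , trans (identityˡ _) (sym (proj₂ (odd-power-split 1F +ˢ))))
      partner-power (𝐜 , +ˢ) = let k , eq = inverse-power (elem (𝐜 , +ˢ)) in
                               inj₁ (k , trans (sym (elem-inverse (𝐜 , +ˢ))) eq)
      partner-power (𝐜 , 0ˢ) = swap (partner-power (𝐞 , 0ˢ))
      partner-power (𝐚 , +ˢ) = swap (partner-power (𝐚 , 0ˢ))
      partner-power (𝐞 , -ˢ) = swap (partner-power (𝐚 , -ˢ))
      partner-power (𝐛 , -ˢ) = swap (partner-power (𝐛 , 0ˢ))
      partner-power (𝐞 , +ˢ) = swap (partner-power (𝐛 , +ˢ))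
      partner-power (𝐜 , -ˢ) = swap (partner-power (𝐜 , +ˢ))

      patched-adjacent : ∀ x → PowerAdj G x (patched x)
      patched-adjacent x = by-cases x (labelled? x)
        where
        by-cases : ∀ x → Dec (Labelled x) → PowerAdj G x (patched x)
        by-cases _ (yes (ℓ , refl)) rewrite patched-labelled ℓ =
          (λ eq → partner-fixfree ℓ (sym (elem-injective eq))) , partner-power ℓ
        by-cases x (no unlabelled) rewrite patched-unlabelled unlabelled =
          (λ x≡x⁻¹ → unlabelled (self-inverse-labelled (trans (cong (x ·_) x≡x⁻¹) (inverseʳ x))))
          , inj₁ (inverse-power x)

      perfect-matching : HasPerfectMatching G
      perfect-matching = involution⇒perfect-matching patched patched-involutive patched-adjacent

mainTheorem8 : (G : FiniteGroup) → ExactlyThreeInvolutions G → InvolutionsNotAllCommute G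
    → IsoToS3 G ⊎ HasPerfectMatching G
mainTheorem8 G three not-all = dichotomy (any? λ z → central? z ×-dec ¬? (z ≟ e))
  where
  open FiniteGroup G using (e)
  open PowerGraph G
  open S₃Pair (noncommuting-pair three not-all)

  dichotomy : Dec (∃ λ z → Central z × z ≢ e) → IsoToS3 G ⊎ HasPerfectMatching G
  dichotomy (yes (z , z-central , z≢e)) =
    let n , zⁿ⁺¹≡e              = period z
        w , w-central , w≢e , j , wᵐ≡e = odd-order-central n z-central z≢e zⁿ⁺¹≡e
    in inj₂ (Matching.perfect-matching w w-central w≢e j wᵐ≡e)
  dichotomy (no none) = inj₁ (isomorphism λ z z-central →
    decidable-stable (z ≟ e) (λ z≢e → none (z , z-central , z≢e)))
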